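{- Let $G$ be a Hamiltonian graph with maximum degree $\Delta(G)\geq 3$. If $G$ is prime, then $G$ is total prime.
   Context: All graphs are finite and simple. A prime labeling of a graph of order $n$ is a bijection from its vertex set to $\{1,\ldots,n\}$ such that labels of adjacent vertices are relatively prime; a graph is prime if it has one. For a graph $G$ with vertex set $V$ and edge set $E$, a total prime labeling is a bijection $\ell: V\cup E\to\{1,2,\ldots,|V|+|E|\}$ such that (i) for every pair of adjacent vertices $u,v$, $\gcd(\ell(u),\ell(v))=1$, and (ii) for every vertex $v$ of degree at least 2, the greatest common divisor of the labels $\ell(uv)$ over all edges $uv$ incident to $v$ equals 1. A graph is total prime if it admits a total prime labeling. -}

module Defs where

open import Data.Nat using (ℕ; zero; suc; _+_; _≤_; _<_; _<ᵇ_)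
open import Data.Nat.Divisibility using (_∣_)
open import Data.Nat.ListAction using (sum)
open import Data.Nat.Properties using (_<?_)
open import Data.Nat.Coprimality using (Coprime)
open import Data.Bool using (Bool; true; false; if_then_else_; _∧_)
open import Data.Fin using (Fin; toℕ; fromℕ<; zero) renaming (_<_ to _<ᶠ_)
open import Data.List using (List; map; allFin; concatMap)
open import Data.Product using (Σ; ∃; _×_; _,_; proj₁; proj₂)
open import Data.Sum using (_⊎_; inj₁; inj₂)
open import Function.Bundles using (_⤖_; Bijection)
open import Relation.Binary.PropositionalEquality using (_≡_)
open import Relation.Nullary using (¬_; yes; no)

record Graph (n : ℕ) : Set where
  field
    adj     : Fin n → Fin n → Bool
    adj-sym : ∀ i j → adj i j ≡ adj j i
    adj-irr : ∀ i → adj i i ≡ false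
open Graph public

Adj : ∀ {n} → Graph n → Fin n → Fin n → Set
Adj G i j = adj G i j ≡ true

degree : ∀ {n} → Graph n → Fin n → ℕ
degree {n} G v = sum (map (λ j → if adj G v j then 1 else 0) (allFin n))

MaxDegreeAtLeast : ∀ {n} → Graph n → ℕ → Set
MaxDegreeAtLeast {n} G k = Σ (Fin n) λ v → k ≤ degree G v

-- edges: unordered pairs {i,j}, represented as (i , j) with i < j and adjacent
Edge : ∀ {n} → Graph n → Set
Edge {n} G = Σ (Fin n × Fin n) λ p → (proj₁ p <ᶠ proj₂ p) × Adj G (proj₁ p) (proj₂ p)

edgeCount : ∀ {n} → Graph n → ℕ
edgeCount {n} G =
  sum (concatMap (λ i → map (λ j → if (toℕ i <ᵇ toℕ j) ∧ adj G i j then 1 else 0) (allFin n)) (allFin n))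

IncidentTo : ∀ {n} {G : Graph n} → Edge G → Fin n → Set
IncidentTo ((i , j) , _) v = (v ≡ i) ⊎ (v ≡ j)

next : ∀ {n} → Fin n → Fin n
next {suc k} i with suc (toℕ i) <? suc k
... | yes p = fromℕ< p
... | no _  = zero

Hamiltonian : ∀ {n} → Graph n → Set
Hamiltonian {n} G = (3 ≤ n) × Σ (Fin n ⤖ Fin n) λ σ →
  ∀ i → Adj G (Bijection.to σ i) (Bijection.to σ (next i))

-- labels are 1..N: a bijection onto Fin N, label = toℕ + 1
lab : ∀ {N} → Fin N → ℕ
lab x = suc (toℕ x)

PrimeLabeling : ∀ {n} → Graph n → Set
PrimeLabeling {n} G = Σ (Fin n ⤖ Fin n) λ f →
  ∀ u v → Adj G u v → Coprime (lab (Bijection.to f u)) (lab (Bijection.to f v))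

IsPrimeGraph : ∀ {n} → Graph n → Set
IsPrimeGraph G = PrimeLabeling G

TotalPrimeLabeling : ∀ {n} → Graph n → Set
TotalPrimeLabeling {n} G = Σ ((Fin n ⊎ Edge G) ⤖ Fin (n + edgeCount G)) λ ℓ →
  let L = λ x → lab (Bijection.to ℓ x) in
  (∀ u v → Adj G u v → Coprime (L (inj₁ u)) (L (inj₁ v)))
  × (∀ v → 2 ≤ degree G v →
       -- gcd of labels of edges incident to v is 1: every common divisor divides 1
       ∀ d → (∀ (e : Edge G) → IncidentTo {G = G} e v → d ∣ L (inj₂ e)) → d ∣ 1)

IsTotalPrime : ∀ {n} → Graph n → Set
IsTotalPrime G = TotalPrimeLabeling G

-- Take a prime labelling of the vertices (labels 1, …, n) and a Hamiltonian
-- cycle v₀ v₁ … v_{n-1} starting at a vertex v₀ of degree at least 3. Pick a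
-- neighbour w of v₀ other than v₁ and v_{n-1}; give the chord v₀w the label
-- n + 1 and the cycle edge vᵢvᵢ₊₁ the label n + 2 + i, and the remaining edges
-- the remaining labels. Then every vertex is incident to two edges with
-- consecutive labels: vᵢ (i ≥ 1) to the cycle edges before and after it, and
-- v₀ to the chord and v₀v₁. Consecutive integers are coprime.
module Submission where

open import Defs
open import Axiom.UniquenessOfIdentityProofs using (module Decidable⇒UIP)
open import Data.Bool using (Bool; true; false; if_then_else_; _∧_)
import Data.Bool.Properties as Bool
open import Data.Fin using (Fin; zero; suc; toℕ; fromℕ; fromℕ<; inject₁; _↑ʳ_; _≟_)
open import Data.Fin.Permutation
  using (Permutation′; _⟨$⟩ʳ_; _⟨$⟩ˡ_; inverseʳ; permutation; _∘ₚ_; transpose)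
import Data.Fin.Permutation.Components as PC
open import Data.Fin.Properties
  using (+↔⊎; toℕ-injective; toℕ<n; toℕ-fromℕ; toℕ-fromℕ<; toℕ-inject₁; toℕ-↑ˡ; toℕ-↑ʳ;
         inject₁-injective; fromℕ≢inject₁; injective⇒≤; any?)
open import Data.Fin.Relation.Unary.Top using (view; ‵fromℕ; ‵inject₁)
open import Data.List using (List; []; _∷_; map; allFin; concatMap; tabulate)
open import Data.List.Properties using (map-tabulate)
open import Data.Nat using (ℕ; zero; suc; _+_; _≤_; _<_; _<ᵇ_; s≤s; z≤n)
open import Data.Nat.Coprimality using (Coprime)
open import Data.Nat.Divisibility using (_∣_; ∣m+n∣m⇒∣n)
open import Data.Nat.ListAction using (sum)
open import Data.Nat.ListAction.Properties using (sum-++)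
open import Data.Nat.Properties
  using (_<?_; <-irrelevant; <-trans; n<1+n; <ᵇ⇒<; <⇒<ᵇ; <⇒≢; <⇒≱; ≤∧≢⇒<; ≮⇒≥; n≮n; +-comm; +-suc)
open import Data.Product using (Σ; ∃; ∃₂; _×_; _,_; proj₁; proj₂; swap)
open import Data.Product.Algebra using (Σ-assoc)
open import Data.Product.Function.Dependent.Propositional using (congˡ)
open import Data.Product.Properties using (Σ-≡,≡→≡; ,-injective)
open import Data.Sum using (_⊎_; inj₁; inj₂; [_,_])
open import Data.Sum.Function.Propositional using (_⊎-↔_)
open import Function using (id; _∘_; Injective)
open import Function.Bundles using (_↔_; Inverse; Injection; Equivalence; mk↔ₛ′)
open import Function.Related.Propositional using (bijection)
open import Function.Properties.Bijection using (⤖⇒↔)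
open import Function.Properties.Inverse using (↔-refl; ↔-sym; ↔-trans; ↔⇒⤖; ↔⇒↣)
open import Relation.Binary.PropositionalEquality
  using (_≡_; _≢_; refl; sym; trans; cong; cong₂; subst; module ≡-Reasoning)
open import Relation.Nullary using (Irrelevant; yes; no; ¬?; contradiction; does)
open import Relation.Nullary.Decidable using (_×-dec_; dec-true; dec-false; decidable-stable)

open Inverse using (to)

↔-injective : ∀ {A B : Set} (f : A ↔ B) → Injective _≡_ _≡_ (to f)
↔-injective f = Injection.injective (↔⇒↣ f)

props↔ : ∀ {A B : Set} → Irrelevant A → Irrelevant B → (A → B) → (B → A) → A ↔ B
props↔ A-irr B-irr f g = mk↔ₛ′ f g (λ _ → B-irr _ _) (λ _ → A-irr _ _)

≡-irrelevantᵇ : {b c : Bool} → Irrelevant (b ≡ c)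
≡-irrelevantᵇ = Decidable⇒UIP.≡-irrelevant Bool._≟_

Σ-cong↔ : ∀ {I : Set} {A B : I → Set} → (∀ i → A i ↔ B i) → Σ I A ↔ Σ I B
Σ-cong↔ A↔B = congˡ {k = bijection} λ {i} → A↔B i

consecutive⇒∣1 : ∀ {d m} → d ∣ m → d ∣ suc m → d ∣ 1
consecutive⇒∣1 {d} {m} d∣m d∣1+m = ∣m+n∣m⇒∣n (subst (d ∣_) (+-comm 1 m) d∣1+m) d∣m

Σ-Fin-suc↔ : ∀ {n} (P : Fin (suc n) → Set) → Σ (Fin (suc n)) P ↔ (P zero ⊎ Σ (Fin n) (P ∘ suc))
Σ-Fin-suc↔ P = mk↔ₛ′
  (λ { (zero , p) → inj₁ p ; (suc i , p) → inj₂ (i , p) })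
  [ (zero ,_) , (λ (i , p) → suc i , p) ]
  (λ { (inj₁ p) → refl ; (inj₂ (i , p)) → refl })
  (λ { (zero , p) → refl ; (suc i , p) → refl })

Σ-Fin↔sum : ∀ n (m : Fin n → ℕ) → Σ (Fin n) (Fin ∘ m) ↔ Fin (sum (tabulate m))
Σ-Fin↔sum zero    m = mk↔ₛ′ (λ { (() , _) }) (λ ()) (λ ()) (λ { (() , _) })
Σ-Fin↔sum (suc n) m = ↔-trans (Σ-Fin-suc↔ (Fin ∘ m))
                      (↔-trans (↔-refl ⊎-↔ Σ-Fin↔sum n (m ∘ suc)) (↔-sym +↔⊎))

≡true↔indicator : ∀ b → (b ≡ true) ↔ Fin (if b then 1 else 0)
≡true↔indicator true  = mk↔ₛ′ (λ _ → zero) (λ _ → refl) (λ { zero → refl }) (λ { refl → refl })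
≡true↔indicator false = mk↔ₛ′ (λ ()) (λ ()) (λ ()) (λ ())

count↔ : ∀ n (b : Fin n → Bool) →
  Σ (Fin n) (λ j → b j ≡ true) ↔ Fin (sum (map (λ j → if b j then 1 else 0) (allFin n)))
count↔ n b = subst (λ xs → Σ (Fin n) (λ j → b j ≡ true) ↔ Fin (sum xs))
  (sym (map-tabulate id (λ j → if b j then 1 else 0)))
  (↔-trans (Σ-cong↔ (≡true↔indicator ∘ b)) (Σ-Fin↔sum n _))

sum-concatMap : ∀ {A : Set} (f : A → List ℕ) xs → sum (concatMap f xs) ≡ sum (map (sum ∘ f) xs)
sum-concatMap f []       = refl
sum-concatMap f (x ∷ xs) =
  trans (sum-++ (f x) (concatMap f xs)) (cong (sum (f x) +_) (sum-concatMap f xs))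

<×≡true↔<ᵇ∧ : ∀ m n b → (m < n × b ≡ true) ↔ ((m <ᵇ n) ∧ b) ≡ true
<×≡true↔<ᵇ∧ m n b = props↔
  (λ (p , q) (p′ , q′) → cong₂ _,_ (<-irrelevant p p′) (≡-irrelevantᵇ q q′)) ≡-irrelevantᵇ
  (λ (m<n , b≡true) → Equivalence.to Bool.T-≡
     (Equivalence.from Bool.T-∧ (<⇒<ᵇ m<n , Equivalence.from Bool.T-≡ b≡true)))
  (λ eq → let t₁ , t₂ = Equivalence.to Bool.T-∧ (Equivalence.from Bool.T-≡ eq)
          in <ᵇ⇒< m n t₁ , Equivalence.to Bool.T-≡ t₂)

neighbours↔degree : ∀ {n} (G : Graph n) v → Σ (Fin n) (Adj G v) ↔ Fin (degree G v)
neighbours↔degree {n} G v = count↔ n (adj G v)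

Edge↔edgeCount : ∀ {n} (G : Graph n) → Edge G ↔ Fin (edgeCount G)
Edge↔edgeCount {n} G = subst (λ c → Edge G ↔ Fin c) (sym edgeCount≡)
  (↔-trans Σ-assoc
  (↔-trans (Σ-cong↔ λ i → Σ-cong↔ λ j → <×≡true↔<ᵇ∧ (toℕ i) (toℕ j) (adj G i j))
  (↔-trans (Σ-cong↔ λ i → count↔ n (isEdge i))
           (Σ-Fin↔sum n _))))
  where
  isEdge : Fin n → Fin n → Bool
  isEdge i j = (toℕ i <ᵇ toℕ j) ∧ adj G i j
  row : Fin n → List ℕ
  row i = map (λ j → if isEdge i j then 1 else 0) (allFin n)
  edgeCount≡ : edgeCount G ≡ sum (tabulate (sum ∘ row))
  edgeCount≡ = trans (sum-concatMap row (allFin n)) (cong sum (map-tabulate id (sum ∘ row)))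

transpose-self : ∀ {m} (i j : Fin m) → PC.transpose i j i ≡ j
transpose-self i j rewrite dec-true (i ≟ i) refl = refl

transpose-other : ∀ {m} {i j k : Fin m} → k ≢ i → k ≢ j → PC.transpose i j k ≡ k
transpose-other {i = i} {j} {k} k≢i k≢j rewrite dec-false (k ≟ i) k≢i | dec-false (k ≟ j) k≢j = refl

extend-to-bijection : ∀ {A : Set} {k m} → A ↔ Fin m → (s : Fin k → A) → Injective _≡_ _≡_ s →
  Σ (A ↔ Fin m) λ ℓ → ∀ i → toℕ (to ℓ (s i)) ≡ toℕ i
extend-to-bijection {k = zero}  e s _     = e , λ ()
extend-to-bijection {k = suc k} e s s-inj = ↔-trans ℓ (transpose a t) , placed
  where
  ℓ,placed = extend-to-bijection e (s ∘ inject₁) (inject₁-injective ∘ s-inj)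
  ℓ = proj₁ ℓ,placed
  a = to ℓ (s (fromℕ k))
  t = fromℕ< (injective⇒≤ (s-inj ∘ ↔-injective e))
  placed : ∀ i → toℕ (PC.transpose a t (to ℓ (s i))) ≡ toℕ i
  placed i with view i
  ... | ‵fromℕ = begin
    toℕ (PC.transpose a t a) ≡⟨ cong toℕ (transpose-self a t) ⟩
    toℕ t                    ≡⟨ toℕ-fromℕ< _ ⟩
    k                        ≡⟨ toℕ-fromℕ k ⟨
    toℕ (fromℕ k)            ∎
    where open ≡-Reasoning
  ... | ‵inject₁ j = begin
    toℕ (PC.transpose a t x) ≡⟨ cong toℕ (transpose-other x≢a x≢t) ⟩
    toℕ x                    ≡⟨ proj₂ ℓ,placed j ⟩
    toℕ j                    ≡⟨ toℕ-inject₁ j ⟨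
    toℕ (inject₁ j)          ∎
    where
    open ≡-Reasoning
    x = to ℓ (s (inject₁ j))
    x≢a : x ≢ a
    x≢a x≡a = fromℕ≢inject₁ (sym (s-inj (↔-injective ℓ x≡a)))
    x≢t : x ≢ t
    x≢t x≡t = <⇒≢ (toℕ<n j) (trans (sym (proj₂ ℓ,placed j)) (trans (cong toℕ x≡t) (toℕ-fromℕ< _)))

module _ {k : ℕ} where

  toℕ-next : (i : Fin (suc k)) → suc (toℕ i) < suc k → toℕ (next i) ≡ suc (toℕ i)
  toℕ-next i 1+i<n with suc (toℕ i) <? suc k
  ... | yes p = toℕ-fromℕ< p
  ... | no ¬p = contradiction 1+i<n ¬p

  next-fromℕ : next (fromℕ k) ≡ zero
  next-fromℕ with suc (toℕ (fromℕ k)) <? suc k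
  ... | yes p = contradiction (subst (λ x → suc x < suc k) (toℕ-fromℕ k) p) (n≮n (suc k))
  ... | no _  = refl

  next-inject₁ : (j : Fin k) → next (inject₁ j) ≡ suc j
  next-inject₁ j = toℕ-injective (trans (toℕ-next (inject₁ j) 1+j<n) (cong suc (toℕ-inject₁ j)))
    where
    1+j<n : suc (toℕ (inject₁ j)) < suc k
    1+j<n = s≤s (subst (_< k) (sym (toℕ-inject₁ j)) (toℕ<n j))

  prev : Fin (suc k) → Fin (suc k)
  prev zero    = fromℕ k
  prev (suc j) = inject₁ j

  next↔ : Permutation′ (suc k)
  next↔ = permutation next prev next-prev prev-next
    where
    next-prev : ∀ i → next (prev i) ≡ i
    next-prev zero    = next-fromℕ
    next-prev (suc j) = next-inject₁ j
    prev-next : ∀ i → prev (next i) ≡ i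
    prev-next i with view i
    ... | ‵fromℕ     = cong prev next-fromℕ
    ... | ‵inject₁ j = cong prev (next-inject₁ j)

  rotate : ℕ → Permutation′ (suc k)
  rotate zero    = ↔-refl
  rotate (suc t) = rotate t ∘ₚ next↔

  rotate-next : ∀ t i → rotate t ⟨$⟩ʳ next i ≡ next (rotate t ⟨$⟩ʳ i)
  rotate-next zero    i = refl
  rotate-next (suc t) i = cong next (rotate-next t i)

  rotate-zero : ∀ i → rotate (toℕ i) ⟨$⟩ʳ zero ≡ i
  rotate-zero i = toℕ-injective (toℕ-rotate-zero (toℕ i) (toℕ<n i))
    where
    toℕ-rotate-zero : ∀ t → t < suc k → toℕ (rotate t ⟨$⟩ʳ zero) ≡ t
    toℕ-rotate-zero zero    _     = refl
    toℕ-rotate-zero (suc t) 1+t<n =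
      trans (toℕ-next _ (subst (λ x → suc x < suc k) (sym ih) 1+t<n)) (cong suc ih)
      where ih = toℕ-rotate-zero t (<-trans (n<1+n t) 1+t<n)

-- Rotations commute with next, so a fixed point of next ∘ next anywhere
-- would give one at zero.
next∘next≢id : ∀ {k} → 3 ≤ suc k → (i : Fin (suc k)) → next (next i) ≢ i
next∘next≢id {suc (suc k)} (s≤s (s≤s (s≤s z≤n))) i next²i≡i = next²0≢0 (↔-injective ρ (begin
  ρ ⟨$⟩ʳ next (next zero)   ≡⟨ rotate-next t (next zero) ⟩
  next (ρ ⟨$⟩ʳ next zero)   ≡⟨ cong next (rotate-next t zero) ⟩
  next (next (ρ ⟨$⟩ʳ zero)) ≡⟨ cong (next ∘ next) (rotate-zero i) ⟩
  next (next i)             ≡⟨ next²i≡i ⟩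
  i                         ≡⟨ rotate-zero i ⟨
  ρ ⟨$⟩ʳ zero               ∎))
  where
  open ≡-Reasoning
  t = toℕ i
  ρ = rotate t
  next²0≢0 : next (next (zero {suc (suc k)})) ≢ zero
  next²0≢0 ()

record HamiltonianCycle {n} (G : Graph n) : Set where
  field
    vertexAt : Permutation′ n
    adjacent : ∀ i → Adj G (vertexAt ⟨$⟩ʳ i) (vertexAt ⟨$⟩ʳ next i)

hamiltonianCycle : ∀ {n} {G : Graph n} → Hamiltonian G → HamiltonianCycle G
hamiltonianCycle (_ , σ , adjacent) = record { vertexAt = ⤖⇒↔ σ ; adjacent = adjacent }

startAt : ∀ {k} {G : Graph (suc k)} → HamiltonianCycle G → ∀ v →
  Σ (HamiltonianCycle G) λ C → HamiltonianCycle.vertexAt C ⟨$⟩ʳ zero ≡ v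
startAt {G = G} C v = record { vertexAt = ρ ∘ₚ vertexAt ; adjacent = adjacent′ } , starts-at-v
  where
  open HamiltonianCycle C
  t = toℕ (vertexAt ⟨$⟩ˡ v)
  ρ = rotate t
  adjacent′ : ∀ i → Adj G (vertexAt ⟨$⟩ʳ (ρ ⟨$⟩ʳ i)) (vertexAt ⟨$⟩ʳ (ρ ⟨$⟩ʳ next i))
  adjacent′ i = subst (λ j → Adj G (vertexAt ⟨$⟩ʳ (ρ ⟨$⟩ʳ i)) (vertexAt ⟨$⟩ʳ j))
                      (sym (rotate-next t i)) (adjacent (ρ ⟨$⟩ʳ i))
  starts-at-v : vertexAt ⟨$⟩ʳ (ρ ⟨$⟩ʳ zero) ≡ v
  starts-at-v = trans (cong (vertexAt ⟨$⟩ʳ_) (rotate-zero _)) (inverseʳ vertexAt)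

module _ {n} (G : Graph n) where

  adj⇒≢ : ∀ {u w} → Adj G u w → u ≢ w
  adj⇒≢ {u} u~u refl with trans (sym u~u) (adj-irr G u)
  ... | ()

  edge : ∀ u w → Adj G u w → Edge G
  edge u w u~w with toℕ u <? toℕ w
  ... | yes u<w = (u , w) , u<w , u~w
  ... | no  u≮w =
    (w , u) , ≤∧≢⇒< (≮⇒≥ u≮w) (adj⇒≢ u~w ∘ sym ∘ toℕ-injective) , trans (adj-sym G w u) u~w

  edge-ends : ∀ u w u~w → proj₁ (edge u w u~w) ≡ (u , w) ⊎ proj₁ (edge u w u~w) ≡ (w , u)
  edge-ends u w u~w with toℕ u <? toℕ w
  ... | yes _ = inj₁ refl
  ... | no  _ = inj₂ refl

  edge-incident : ∀ u w u~w →
    IncidentTo {G = G} (edge u w u~w) u × IncidentTo {G = G} (edge u w u~w) w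
  edge-incident u w u~w with toℕ u <? toℕ w
  ... | yes _ = inj₁ refl , inj₂ refl
  ... | no  _ = inj₂ refl , inj₁ refl

  edge-≡ : ∀ {u w u~w u′ w′ u′~w′} → edge u w u~w ≡ edge u′ w′ u′~w′ →
    (u ≡ u′ × w ≡ w′) ⊎ (u ≡ w′ × w ≡ u′)
  edge-≡ {u} {w} {u~w} {u′} {w′} {u′~w′} eq
    with edge-ends u w u~w | edge-ends u′ w′ u′~w′
  ... | inj₁ p | inj₁ q = inj₁ (,-injective (trans (sym p) (trans (cong proj₁ eq) q)))
  ... | inj₁ p | inj₂ q = inj₂ (,-injective (trans (sym p) (trans (cong proj₁ eq) q)))
  ... | inj₂ p | inj₁ q = inj₂ (swap (,-injective (trans (sym p) (trans (cong proj₁ eq) q))))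
  ... | inj₂ p | inj₂ q = inj₁ (swap (,-injective (trans (sym p) (trans (cong proj₁ eq) q))))

-- If every value of f lay in {a , b}, then "f i ≡ a?" would inject Fin m into Fin 2.
avoid-two : ∀ {m n} → 2 < m → (f : Fin m → Fin n) → Injective _≡_ _≡_ f →
  ∀ a b → ∃ λ i → f i ≢ a × f i ≢ b
avoid-two {m} 2<m f f-inj a b with any? (λ i → ¬? (f i ≟ a) ×-dec ¬? (f i ≟ b))
... | yes found = found
... | no  none  = contradiction (injective⇒≤ side-injective) (<⇒≱ 2<m)
  where
  side : Fin m → Fin 2
  side i = if does (f i ≟ a) then zero else suc zero
  hits-b : ∀ i → f i ≢ a → f i ≡ b
  hits-b i fi≢a = decidable-stable (f i ≟ b) (λ fi≢b → none (i , fi≢a , fi≢b))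
  side-injective : Injective _≡_ _≡_ side
  side-injective {i} {j} eq with f i ≟ a | f j ≟ a
  ... | yes fi≡a | yes fj≡a = f-inj (trans fi≡a (sym fj≡a))
  ... | no  fi≢a | no  fj≢a = f-inj (trans (hits-b i fi≢a) (sym (hits-b j fj≢a)))
  ... | yes _    | no  _    = contradiction eq λ ()
  ... | no  _    | yes _    = contradiction eq λ ()

neighbour-avoiding : ∀ {n} (G : Graph n) {v} → 3 ≤ degree G v →
  ∀ a b → ∃ λ w → Adj G v w × w ≢ a × w ≢ b
neighbour-avoiding G {v} 3≤deg a b =
  let i , i≢a , i≢b = avoid-two 3≤deg (proj₁ ∘ to N) neighbour-injective a b
  in proj₁ (to N i) , proj₂ (to N i) , i≢a , i≢b
  where
  N = ↔-sym (neighbours↔degree G v)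
  neighbour-injective : Injective _≡_ _≡_ (proj₁ ∘ to N)
  neighbour-injective eq = ↔-injective N (Σ-≡,≡→≡ (eq , ≡-irrelevantᵇ _ _))

ConsecutiveAt : ∀ {n} (G : Graph n) → (Edge G → ℕ) → Fin n → Set
ConsecutiveAt G ℓ u =
  ∃₂ λ e e′ → IncidentTo {G = G} e u × IncidentTo {G = G} e′ u × ℓ e′ ≡ suc (ℓ e)

totalPrimeLabeling : ∀ {n} (G : Graph n) → PrimeLabeling G → (ℓ : Edge G ↔ Fin (edgeCount G)) →
  (∀ u → ConsecutiveAt G (toℕ ∘ to ℓ) u) → TotalPrimeLabeling G
totalPrimeLabeling {n} G (f , f-coprime) ℓ consecutive = ↔⇒⤖ L , vertex-coprime , edge-gcd
  where
  m = edgeCount G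
  L : (Fin n ⊎ Edge G) ↔ Fin (n + m)
  L = ↔-trans (⤖⇒↔ f ⊎-↔ ℓ) (↔-sym +↔⊎)
  vertex-coprime : ∀ u v → Adj G u v → Coprime (lab (to L (inj₁ u))) (lab (to L (inj₁ v)))
  vertex-coprime u v u~v
    rewrite toℕ-↑ˡ (to (⤖⇒↔ f) u) m | toℕ-↑ˡ (to (⤖⇒↔ f) v) m = f-coprime u v u~v
  edge-gcd : ∀ u → 2 ≤ degree G u →
    ∀ d → (∀ e → IncidentTo {G = G} e u → d ∣ lab (to L (inj₂ e))) → d ∣ 1
  edge-gcd u _ d d∣incident =
    let e , e′ , e∋u , e′∋u , ℓe′≡1+ℓe = consecutive u
    in consecutive⇒∣1 (d∣incident e e∋u)
                      (subst (λ x → d ∣ suc x) (shift-suc ℓe′≡1+ℓe) (d∣incident e′ e′∋u))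
    where
    shift-suc : ∀ {x y : Fin m} → toℕ y ≡ suc (toℕ x) → toℕ (n ↑ʳ y) ≡ suc (toℕ (n ↑ʳ x))
    shift-suc {x} {y} y≡1+x = begin
      toℕ (n ↑ʳ y)        ≡⟨ toℕ-↑ʳ n y ⟩
      n + toℕ y           ≡⟨ cong (n +_) y≡1+x ⟩
      n + suc (toℕ x)     ≡⟨ +-suc n (toℕ x) ⟩
      suc (n + toℕ x)     ≡⟨ cong suc (toℕ-↑ʳ n x) ⟨
      suc (toℕ (n ↑ʳ x))  ∎
      where open ≡-Reasoning

module ChordAndCycle {k} {G : Graph (suc k)} (3≤n : 3 ≤ suc k) (C : HamiltonianCycle G) where

  open HamiltonianCycle C

  τ : Fin (suc k) → Fin (suc k)
  τ i = vertexAt ⟨$⟩ʳ i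

  cycleEdge : Fin (suc k) → Edge G
  cycleEdge i = edge G (τ i) (τ (next i)) (adjacent i)

  cycleEdge-injective : Injective _≡_ _≡_ cycleEdge
  cycleEdge-injective {i} {j} eq with edge-≡ G eq
  ... | inj₁ (τi≡τj , _) = ↔-injective vertexAt τi≡τj
  ... | inj₂ (τi≡τ⁺j , τ⁺i≡τj) = contradiction
    (trans (cong next (sym (↔-injective vertexAt τi≡τ⁺j))) (↔-injective vertexAt τ⁺i≡τj))
    (next∘next≢id 3≤n j)

  module _ {w} (v~w : Adj G (τ zero) w) (w≢τ₁ : w ≢ τ (next zero)) (w≢τₗ : w ≢ τ (fromℕ k)) where

    chord : Edge G
    chord = edge G (τ zero) w v~w

    chord≢cycleEdge : ∀ i → chord ≢ cycleEdge i
    chord≢cycleEdge i eq with edge-≡ G eq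
    ... | inj₁ (τ₀≡τi , w≡τ⁺i) =
      w≢τ₁ (subst (λ j → w ≡ τ (next j)) (sym (↔-injective vertexAt τ₀≡τi)) w≡τ⁺i)
    ... | inj₂ (τ₀≡τ⁺i , w≡τi) = w≢τₗ (trans w≡τi (cong τ i≡last))
      where
      i≡last : i ≡ fromℕ k
      i≡last = ↔-injective next↔ (trans (sym (↔-injective vertexAt τ₀≡τ⁺i)) (sym next-fromℕ))

    chordThenCycle : Fin (suc (suc k)) → Edge G
    chordThenCycle zero    = chord
    chordThenCycle (suc i) = cycleEdge i

    chordThenCycle-injective : Injective _≡_ _≡_ chordThenCycle
    chordThenCycle-injective {zero}  {zero}  _  = refl
    chordThenCycle-injective {zero}  {suc j} eq = contradiction eq (chord≢cycleEdge j)
    chordThenCycle-injective {suc i} {zero}  eq = contradiction (sym eq) (chord≢cycleEdge i)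
    chordThenCycle-injective {suc i} {suc j} eq = cong suc (cycleEdge-injective eq)

    chordThenCycle-incident : ∀ i → IncidentTo {G = G} (chordThenCycle (inject₁ i)) (τ i)
                                   × IncidentTo {G = G} (chordThenCycle (suc i)) (τ i)
    chordThenCycle-incident zero =
      proj₁ (edge-incident G _ _ v~w) , proj₁ (edge-incident G _ _ (adjacent zero))
    chordThenCycle-incident (suc j) =
      subst (IncidentTo {G = G} (cycleEdge (inject₁ j)) ∘ τ) (next-inject₁ j)
            (proj₂ (edge-incident G _ _ (adjacent (inject₁ j))))
      , proj₁ (edge-incident G _ _ (adjacent (suc j)))

  totalPrime : 3 ≤ degree G (τ zero) → PrimeLabeling G → TotalPrimeLabeling G
  totalPrime 3≤deg prime with neighbour-avoiding G 3≤deg (τ (next zero)) (τ (fromℕ k))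
  ... | w , v~w , w≢τ₁ , w≢τₗ = totalPrimeLabeling G prime ℓ consecutive
    where
    ℓ,placed = extend-to-bijection (Edge↔edgeCount G) (chordThenCycle v~w w≢τ₁ w≢τₗ)
                                   (chordThenCycle-injective v~w w≢τ₁ w≢τₗ)
    ℓ = proj₁ ℓ,placed
    placed = proj₂ ℓ,placed
    consecutive-at-τ : ∀ i → ConsecutiveAt G (toℕ ∘ to ℓ) (τ i)
    consecutive-at-τ i =
      let e∋τi , e′∋τi = chordThenCycle-incident v~w w≢τ₁ w≢τₗ i
      in _ , _ , e∋τi , e′∋τi ,
         trans (placed (suc i)) (cong suc (sym (trans (placed (inject₁ i)) (toℕ-inject₁ i))))
    consecutive : ∀ u → ConsecutiveAt G (toℕ ∘ to ℓ) u
    consecutive u = subst (ConsecutiveAt G (toℕ ∘ to ℓ)) (inverseʳ vertexAt)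
                          (consecutive-at-τ (vertexAt ⟨$⟩ˡ u))

mainTheorem3 : ∀ {n : ℕ} (G : Graph n) → Hamiltonian G → MaxDegreeAtLeast G 3 →
    IsPrimeGraph G → IsTotalPrime G
mainTheorem3 {zero}  G (() , _) _ _
mainTheorem3 {suc k} G ham@(3≤n , _) (v , 3≤deg) prime =
  let C , starts-at-v = startAt {G = G} (hamiltonianCycle ham) v
  in ChordAndCycle.totalPrime 3≤n C (subst (λ u → 3 ≤ degree G u) (sym starts-at-v) 3≤deg) prime
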